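{- Let $n\ge 1$, let $A=\{a_1,\dots,a_n\}$ and $S$ the power set of $A$, equipped with the operation $u\rightarrow u' = u\oplus u'$ (symmetric difference). Let $\mathbb{Z}_2^n$ carry coordinatewise addition modulo $2$. Define $f:S\to\mathbb{Z}_2^n$ by $f(u)=(s_1,\dots,s_n)$ with $s_j\equiv\#\{i: a_i\in u,\ i\mid j\}\pmod 2$. Then $f$ is a group isomorphism from $\langle S,\rightarrow\rangle$ to $\langle\mathbb{Z}_2^n,+\rangle$.
   Context: Locker problem: $n$ lockers, students $a_1,\dots,a_n$; starting with all lockers closed, each student $a_i$ in $u$ toggles every locker whose number is a multiple of $i$, and $f(u)$ is the final state ($1$ = open). The operation $\rightarrow$ ("then the next students change the lockers") on subsets of students coincides with symmetric difference, since a student acting twice has no net effect and order does not matter. -}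

module Defs where

open import Data.Nat using (ℕ; suc; _%_)
open import Data.Nat.Divisibility using (_∣_; _∣?_)
open import Data.Fin using (Fin; toℕ; fromℕ<)
open import Data.Fin.Subset using (Subset; inside; outside; _∈_)
open import Data.Fin.Subset.Properties using (_∈?_)
open import Data.Bool using (Bool; _xor_)
open import Data.Vec using (Vec; zipWith; tabulate; lookup)
open import Data.List using (List; length; filter)
open import Data.List using () renaming (allFin to allFinL)
open import Data.Nat.DivMod using (_mod_)
open import Relation.Nullary.Decidable using (_×-dec_)
open import Data.Product using (_×_)
open import Relation.Binary.PropositionalEquality using (_≡_)
open import Function.Definitions using (Bijective)

-- Students a_1..a_n are indexed by Fin n: index i : Fin n is student a_{toℕ i + 1}.
-- Likewise lockers 1..n are indexed by Fin n.

Z₂ : Set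
Z₂ = Fin 2

_+₂_ : Z₂ → Z₂ → Z₂
a +₂ b = (toℕ a Data.Nat.+ toℕ b) mod 2

Z₂^ : ℕ → Set
Z₂^ n = Vec Z₂ n

_⊕ᶻ_ : ∀ {n} → Z₂^ n → Z₂^ n → Z₂^ n
_⊕ᶻ_ = zipWith _+₂_

S : ℕ → Set
S n = Subset n

_⇒_ : ∀ {n} → S n → S n → S n
_⇒_ = zipWith _xor_

f : ∀ {n} → S n → Z₂^ n
f {n} u = tabulate λ j →
  ((length (filter (λ i → (i ∈? u) ×-dec (suc (toℕ i) ∣? suc (toℕ j))) (allFinL n))) mod 2)

IsGroupIso : ∀ {n} → (S n → Z₂^ n) → Set
IsGroupIso {n} g =
  (∀ (u u' : S n) → g (u ⇒ u') ≡ (g u ⊕ᶻ g u')) × Bijective _≡_ _≡_ g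

-- Over GF(2) = (Bool, xor, ∧) the locker map is the vector-matrix product u ↦ u · D with the
-- divisibility matrix D i j = [i ∣ j], so it is additive. D is upper unitriangular, since i ∣ i
-- and i ∣ j forces i ≤ j: only student a₁ touches locker 1, which fixes whether a₁ ∈ u, and the
-- remaining students and lockers form again a unitriangular system. Forward substitution therefore
-- solves u · D = w uniquely for every w.
module Submission where

open import Defs
open import Data.Nat using (ℕ; zero; suc; _≥_; s≤s; z≤n)
open import Data.Nat.Properties using (<⇒≱)
open import Data.Nat.DivMod using (_mod_)
open import Data.Nat.Divisibility using (_∣_; _∣?_; ∣⇒≤; ∣-refl)
open import Data.Fin as Fin using (Fin; toℕ)
open import Data.Fin.Properties using (2↔Bool)
open import Data.Fin.Subset using (Subset; _∈_)
open import Data.Fin.Subset.Properties using (_∈?_)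
open import Data.Bool using (Bool; true; false; not; _∧_; _xor_)
open import Data.Bool.Properties
  using (not-involutive; ∧-identityʳ; ∧-zeroʳ; xor-identityʳ; ∧-distribʳ-xor; xor-∧-commutativeRing)
open import Data.Vec using (Vec; []; _∷_; lookup; tabulate; zipWith; map)
open import Data.Vec.Properties
  using (tabulate-cong; tabulate-∘; lookup-zipWith; ∷-injective; map-∘; map-cong; map-id)
open import Data.List as List using (length; filter)
open import Data.Product as Product using (∃; _,_)
open import Algebra.Bundles using (CommutativeRing)
open import Function.Base using (_∘_)
open import Function.Bundles using (Inverse)
open import Function.Definitions using (Injective; Surjective)
open import Relation.Nullary.Decidable using (does; dec-true; dec-false; _×-dec_)
open import Relation.Unary using (Pred; Decidable)
open import Relation.Binary.PropositionalEquality
open ≡-Reasoning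

open CommutativeRing xor-∧-commutativeRing using (+-commutativeMonoid; +-rawMonoid)
open import Algebra.Properties.CommutativeMonoid.Sum +-commutativeMonoid
  using (sum-syntax; sum-cong-≗; sum-replicate-zero; ∑-distrib-+)
open import Algebra.Definitions.RawMonoid +-rawMonoid using (_×_)

Matrix : ℕ → Set
Matrix n = Fin n → Fin n → Bool

infixl 25 _·_

_·_ : ∀ {n} → Subset n → Matrix n → Subset n
_·_ {n} u M = tabulate λ j → ∑[ i < n ] (lookup u i ∧ M i j)

record IsUpperUnitriangular {n} (M : Matrix n) : Set where
  field
    diagonal   : ∀ i → M i i ≡ true
    below-zero : ∀ {i j} → j Fin.< i → M i j ≡ false

minor : ∀ {n} → Matrix (suc n) → Matrix n
minor M i j = M (Fin.suc i) (Fin.suc j)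

minor-unitriangular : ∀ {n} {M : Matrix (suc n)} →
  IsUpperUnitriangular M → IsUpperUnitriangular (minor M)
minor-unitriangular U = record
  { diagonal   = λ i → diagonal (Fin.suc i)
  ; below-zero = λ j<i → below-zero (s≤s j<i)
  }
  where open IsUpperUnitriangular U

zipWith-tabulate : ∀ {A B C : Set} {n} (_∙_ : A → B → C) (g : Fin n → A) (h : Fin n → B) →
  zipWith _∙_ (tabulate g) (tabulate h) ≡ tabulate (λ j → g j ∙ h j)
zipWith-tabulate {n = zero}  _∙_ g h = refl
zipWith-tabulate {n = suc n} _∙_ g h = cong (_ ∷_) (zipWith-tabulate _∙_ (g ∘ Fin.suc) (h ∘ Fin.suc))

r⇒[r⇒u]≡u : ∀ {n} (r u : Subset n) → r ⇒ (r ⇒ u) ≡ u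
r⇒[r⇒u]≡u []          []      = refl
r⇒[r⇒u]≡u (true  ∷ r) (b ∷ u) = cong₂ _∷_ (not-involutive b) (r⇒[r⇒u]≡u r u)
r⇒[r⇒u]≡u (false ∷ r) (b ∷ u) = cong (b ∷_) (r⇒[r⇒u]≡u r u)

·-distribʳ-⇒ : ∀ {n} (M : Matrix n) (u v : Subset n) → (u ⇒ v) · M ≡ u · M ⇒ v · M
·-distribʳ-⇒ {n} M u v = begin
  (u ⇒ v) · M
    ≡⟨ tabulate-cong (λ j → trans (sum-cong-≗ (distrib j))
                                   (∑-distrib-+ (λ i → lookup u i ∧ M i j) (λ i → lookup v i ∧ M i j))) ⟩
  tabulate (λ j → ∑[ i < n ] (lookup u i ∧ M i j) xor ∑[ i < n ] (lookup v i ∧ M i j))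
    ≡⟨ zipWith-tabulate _xor_ _ _ ⟨
  u · M ⇒ v · M ∎
  where
  distrib : ∀ j i → lookup (u ⇒ v) i ∧ M i j ≡ (lookup u i ∧ M i j) xor (lookup v i ∧ M i j)
  distrib j i = trans (cong (_∧ M i j) (lookup-zipWith _xor_ i u v))
                      (∧-distribʳ-xor (M i j) (lookup u i) (lookup v i))

scaledFirstRow : ∀ {n} → Matrix (suc n) → Bool → Subset n
scaledFirstRow M b = tabulate λ j → b ∧ M Fin.zero (Fin.suc j)

·-∷ : ∀ {n} {M : Matrix (suc n)} → IsUpperUnitriangular M → ∀ b (v : Subset n) →
  (b ∷ v) · M ≡ b ∷ scaledFirstRow M b ⇒ v · minor M
·-∷ {n} {M} U b v = cong₂ _∷_ first-locker (sym (zipWith-tabulate _xor_ _ _))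
  where
  open IsUpperUnitriangular U
  first-locker : (b ∧ M Fin.zero Fin.zero) xor ∑[ i < n ] (lookup v i ∧ M (Fin.suc i) Fin.zero) ≡ b
  first-locker = begin
    (b ∧ M Fin.zero Fin.zero) xor ∑[ i < n ] (lookup v i ∧ M (Fin.suc i) Fin.zero)
      ≡⟨ cong₂ _xor_ (cong (b ∧_) (diagonal Fin.zero))
                     (sum-cong-≗ λ i → trans (cong (lookup v i ∧_) (below-zero (s≤s z≤n))) (∧-zeroʳ _)) ⟩
    (b ∧ true) xor ∑[ i < n ] false
      ≡⟨ cong₂ _xor_ (∧-identityʳ b) (sum-replicate-zero n) ⟩
    b xor false
      ≡⟨ xor-identityʳ b ⟩
    b ∎

·-injective : ∀ {n} {M : Matrix n} → IsUpperUnitriangular M → Injective _≡_ _≡_ (_· M)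
·-injective {zero}  _ {[]} {[]} _ = refl
·-injective {suc n} {M} U {b ∷ u} {c ∷ v} eq
  with ∷-injective (trans (sym (·-∷ U b u)) (trans eq (·-∷ U c v)))
... | refl , rows = cong (b ∷_) (·-injective (minor-unitriangular U) (begin
  u · minor M                      ≡⟨ r⇒[r⇒u]≡u r _ ⟨
  r ⇒ (r ⇒ u · minor M)            ≡⟨ cong (r ⇒_) rows ⟩
  r ⇒ (r ⇒ v · minor M)            ≡⟨ r⇒[r⇒u]≡u r _ ⟩
  v · minor M                      ∎))
  where r = scaledFirstRow M b

·-surjective : ∀ {n} {M : Matrix n} → IsUpperUnitriangular M → ∀ w → ∃ λ u → u · M ≡ w
·-surjective {zero}  _ [] = [] , refl
·-surjective {suc n} {M} U (c ∷ w)
  with ·-surjective (minor-unitriangular U) (scaledFirstRow M c ⇒ w)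
... | v , v·M≡r⇒w = c ∷ v , (begin
  (c ∷ v) · M                      ≡⟨ ·-∷ U c v ⟩
  c ∷ r ⇒ v · minor M              ≡⟨ cong (λ t → c ∷ r ⇒ t) v·M≡r⇒w ⟩
  c ∷ r ⇒ (r ⇒ w)                  ≡⟨ cong (c ∷_) (r⇒[r⇒u]≡u r w) ⟩
  c ∷ w                            ∎)
  where r = scaledFirstRow M c

divisibility : ∀ {n} → Matrix n
divisibility i j = does (suc (toℕ i) ∣? suc (toℕ j))

divisibility-unitriangular : ∀ {n} → IsUpperUnitriangular (divisibility {n})
divisibility-unitriangular = record
  { diagonal   = λ i → dec-true (suc (toℕ i) ∣? suc (toℕ i)) ∣-refl
  ; below-zero = λ {i} {j} j<i → dec-false (suc (toℕ i) ∣? suc (toℕ j)) (<⇒≱ (s≤s j<i) ∘ ∣⇒≤)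
  }

bit : Bool → Z₂
bit = Inverse.from 2↔Bool

bool : Z₂ → Bool
bool = Inverse.to 2↔Bool

bit-xor : ∀ a b → bit (a xor b) ≡ bit a +₂ bit b
bit-xor true  true  = refl
bit-xor true  false = refl
bit-xor false true  = refl
bit-xor false false = refl

map-bit-⇒ : ∀ {n} (u v : Subset n) → map bit (u ⇒ v) ≡ map bit u ⊕ᶻ map bit v
map-bit-⇒ []      []      = refl
map-bit-⇒ (a ∷ u) (b ∷ v) = cong₂ _∷_ (bit-xor a b) (map-bit-⇒ u v)

map-inverse : ∀ {A B : Set} {g : A → B} {h : B → A} → (∀ y → g (h y) ≡ y) →
  ∀ {n} (ys : Vec B n) → map g (map h ys) ≡ ys
map-inverse {g = g} {h} inv ys = trans (sym (map-∘ g h ys)) (trans (map-cong inv ys) (map-id ys))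

map-bit-injective : ∀ {n} → Injective _≡_ _≡_ (map {n = n} bit)
map-bit-injective {x = u} {v} eq = begin
  u                    ≡⟨ map-inverse (Inverse.strictlyInverseˡ 2↔Bool) u ⟨
  map bool (map bit u) ≡⟨ cong (map bool) eq ⟩
  map bool (map bit v) ≡⟨ map-inverse (Inverse.strictlyInverseˡ 2↔Bool) v ⟩
  v                    ∎

-- m × true is the m-fold xor of true, i.e. the parity of m.
mod-2≡bit : ∀ m → m mod 2 ≡ bit (m × true)
mod-2≡bit zero          = refl
mod-2≡bit (suc zero)    = refl
mod-2≡bit (suc (suc m)) = trans (mod-2≡bit m) (cong bit (sym (not-involutive _)))

length-filter-parity : ∀ {A : Set} {ℓ} {P : Pred A ℓ} (P? : Decidable P) {n} (g : Fin n → A) →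
  length (filter P? (List.tabulate g)) × true ≡ ∑[ i < n ] does (P? (g i))
length-filter-parity P? {zero}  g = refl
length-filter-parity P? {suc n} g
  with does (P? (g Fin.zero)) | length-filter-parity P? (g ∘ Fin.suc)
... | true  | ih = cong not ih
... | false | ih = ih

does-∈?≡lookup : ∀ {n} (i : Fin n) (u : Subset n) → does (i ∈? u) ≡ lookup u i
does-∈?≡lookup Fin.zero    (true  ∷ u) = refl
does-∈?≡lookup Fin.zero    (false ∷ u) = refl
does-∈?≡lookup (Fin.suc i) (b ∷ u)     = does-∈?≡lookup i u

f≡map-bit-· : ∀ {n} (u : S n) → f u ≡ map bit (u · divisibility)
f≡map-bit-· {n} u = trans (tabulate-cong locker) (tabulate-∘ bit _)
  where
  toggles? : ∀ j → Decidable λ i → i ∈ u Product.× suc (toℕ i) ∣ suc (toℕ j)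
  toggles? j i = (i ∈? u) ×-dec (suc (toℕ i) ∣? suc (toℕ j))

  togglers : Fin n → ℕ
  togglers j = length (filter (toggles? j) (List.allFin n))

  locker : ∀ j → togglers j mod 2 ≡ bit (∑[ i < n ] (lookup u i ∧ divisibility i j))
  locker j = begin
    togglers j mod 2                                   ≡⟨ mod-2≡bit (togglers j) ⟩
    bit (togglers j × true)                            ≡⟨ cong bit (length-filter-parity (toggles? j) (λ i → i)) ⟩
    bit (∑[ i < n ] (does (i ∈? u) ∧ divisibility i j)) ≡⟨ cong bit (sum-cong-≗ λ i →
                                                            cong (_∧ divisibility i j) (does-∈?≡lookup i u)) ⟩
    bit (∑[ i < n ] (lookup u i ∧ divisibility i j))    ∎

theorem3 : (n : ℕ) → n ≥ 1 → IsGroupIso {n} f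
theorem3 n _ = homomorphic , injective , surjective
  where
  homomorphic : ∀ (u u' : S n) → f (u ⇒ u') ≡ f u ⊕ᶻ f u'
  homomorphic u u' = begin
    f (u ⇒ u')
      ≡⟨ f≡map-bit-· (u ⇒ u') ⟩
    map bit ((u ⇒ u') · divisibility)
      ≡⟨ cong (map bit) (·-distribʳ-⇒ divisibility u u') ⟩
    map bit (u · divisibility ⇒ u' · divisibility)
      ≡⟨ map-bit-⇒ (u · divisibility) (u' · divisibility) ⟩
    map bit (u · divisibility) ⊕ᶻ map bit (u' · divisibility)
      ≡⟨ cong₂ _⊕ᶻ_ (f≡map-bit-· u) (f≡map-bit-· u') ⟨
    f u ⊕ᶻ f u' ∎

  injective : Injective _≡_ _≡_ (f {n})
  injective {u} {v} eq = ·-injective divisibility-unitriangular (map-bit-injective (begin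
    map bit (u · divisibility) ≡⟨ f≡map-bit-· u ⟨
    f u                        ≡⟨ eq ⟩
    f v                        ≡⟨ f≡map-bit-· v ⟩
    map bit (v · divisibility) ∎))

  surjective : Surjective _≡_ _≡_ (f {n})
  surjective y with ·-surjective divisibility-unitriangular (map bool y)
  ... | u , u·D≡y = u , λ { refl → begin
    f u                        ≡⟨ f≡map-bit-· u ⟩
    map bit (u · divisibility) ≡⟨ cong (map bit) u·D≡y ⟩
    map bit (map bool y)       ≡⟨ map-inverse (Inverse.strictlyInverseʳ 2↔Bool) y ⟩
    y                          ∎ }
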